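{- Let $G\in\mathcal S_8$. If $C$ is a coclique in $G$, then $|C|\le 4$, and if $|C|=4$ then $C$ is $2$-regular, i.e. every vertex of $G$ outside $C$ is adjacent to exactly two vertices of $C$.
   Context: Graphs are finite and simple. Seidel switching of $G$ w.r.t. $X\subseteq V(G)$ gives $G_X$ on $V(G)$, where $u,v$ are adjacent iff adjacent in $G$ with both or neither in $X$, or non-adjacent in $G$ with exactly one in $X$. $\mathcal S_8$ is the class of graphs isomorphic to $L(H)_X$ for some graph $H$ on $8$ vertices and some $X\subseteq E(H)$, with $L(H)$ the line graph. -}

module Defs where

open import Data.Nat using (ℕ; _≤_)
open import Data.Bool using (Bool; true; false; not; _∧_; _∨_; _xor_; if_then_else_)
open import Data.Fin using (Fin; _<_; _≟_)
open import Data.Fin.Subset using (Subset; _∈_; _∉_; _∩_; ∣_∣)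
open import Data.Vec using (tabulate)
open import Data.Product using (Σ; _×_; proj₁; proj₂; ∃)
open import Relation.Nullary.Decidable using (⌊_⌋)
open import Relation.Binary.PropositionalEquality using (_≡_)
open import Function.Bundles using (Bijection)
open import Function.Bundles using (_⤖_)

record Graph (V : Set) : Set where
  field
    adj    : V → V → Bool
    symm   : ∀ u v → adj u v ≡ adj v u
    irrefl : ∀ v → adj v v ≡ false
open Graph public

switch : {V : Set} → (V → V → Bool) → (V → Bool) → V → V → Bool
switch a X u v = if X u xor X v then not (a u v) else a u v

Edge : {m : ℕ} → Graph (Fin m) → Set
Edge {m} H = Σ (Fin m) λ i → Σ (Fin m) λ j → (i < j) × (adj H i j ≡ true)

src tgt : {m : ℕ} (H : Graph (Fin m)) → Edge H → Fin m
src H e = proj₁ e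
tgt H e = proj₁ (proj₂ e)

_==_ : {m : ℕ} → Fin m → Fin m → Bool
i == j = ⌊ i ≟ j ⌋

lineAdj : {m : ℕ} (H : Graph (Fin m)) → Edge H → Edge H → Bool
lineAdj H e f =
  ((src H e == src H f) ∨ (src H e == tgt H f) ∨ (tgt H e == src H f) ∨ (tgt H e == tgt H f))
  ∧ not ((src H e == src H f) ∧ (tgt H e == tgt H f))

IsoToSwitchedLine : {n m : ℕ} → Graph (Fin n) → (H : Graph (Fin m)) → (Edge H → Bool) → Set
IsoToSwitchedLine {n} G H X =
  Σ (Fin n ⤖ Edge H) λ φ →
    ∀ u v → adj G u v ≡ switch (lineAdj H) X (Bijection.to φ u) (Bijection.to φ v)

InS8 : {n : ℕ} → Graph (Fin n) → Set
InS8 G = Σ (Graph (Fin 8)) λ H → Σ (Edge H → Bool) λ X → IsoToSwitchedLine G H X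

IsCoclique : {n : ℕ} → Graph (Fin n) → Subset n → Set
IsCoclique G C = ∀ u v → u ∈ C → v ∈ C → adj G u v ≡ false

nbhd : {n : ℕ} → Graph (Fin n) → Fin n → Subset n
nbhd G v = tabulate (adj G v)

-- Send the edge {i,j} of H to the vector of ℤ⁸ with entries 3 at i and j and −1 elsewhere,
-- multiplied by −1 when the edge lies in X. Two such vectors have inner product 24, 8 or −8
-- according as the edges coincide, are adjacent in L(H)_X or are not, so G ∈ 𝒮₈ has a Gram
-- representation 24 I + 8 (A − Ā). If S is the sum of the vectors of a coclique C of size k,
-- then 0 ≤ S·S = 24 k − 8 k (k − 1), whence k ≤ 4; and when k = 4, S = 0, so for v ∉ C with
-- m neighbours in C, 0 = S·v = 8 m − 8 (4 − m).
module Submission where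

open import Defs
open import Data.Nat using (ℕ; _≤_)
open import Data.Fin using (Fin)
open import Data.Fin.Subset using (Subset; _∉_; _∩_; ∣_∣)
open import Data.Product using (_×_)
open import Relation.Binary.PropositionalEquality using (_≡_)

open import Axiom.UniquenessOfIdentityProofs using (module Decidable⇒UIP)
open import Data.Bool using (Bool; true; false; not; _∧_; _∨_; _xor_; if_then_else_)
import Data.Bool.Properties as 𝔹
open import Data.Fin using (zero; suc; _<_; _<?_; _≟_)
import Data.Fin.Properties as Fin
open import Data.Fin.Properties using (all?)
open import Data.Fin.Subset using (_∈_)
open import Data.Integer as ℤ using (ℤ; +_; -_; -[1+_]; _+_; _*_; +≤+)
open import Data.Integer.Properties as ℤP using (+-*-semiring)
open import Data.Integer.Tactic.RingSolver using (solve-∀)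
open import Data.Nat as ℕ using (suc; z≤n; z<s; >-nonZero)
import Data.Nat.Properties as ℕP
open import Data.Product using (Σ; _,_; proj₁; proj₂)
open import Data.Sum using (inj₁; inj₂)
open import Data.Unit using (tt)
open import Data.Vec using ([]; _∷_; lookup; tabulate)
open import Data.Vec.Functional using (Vector)
open import Data.Vec.Properties using ([]=⇒lookup; lookup⇒[]=)
open import Function using (_∘_)
open import Function.Bundles using (Bijection)
open import Relation.Nullary using (yes; no; ¬_; contradiction)
open import Relation.Nullary.Decidable using (toWitness; _→-dec_)
open import Algebra.Properties.Semiring.Sum +-*-semiring
  using (sum; sum-syntax; sum-cong-≗; sum-replicate-zero; ∑-distrib-+; ∑-comm; *-distribˡ-sum; *-distribʳ-sum)
open import Relation.Binary.PropositionalEquality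
  using (_≢_; refl; sym; trans; cong; cong₂; subst; module ≡-Reasoning)

infix 7 _·_

_·_ : ∀ {d} → Vector ℤ d → Vector ℤ d → ℤ
x · y = sum λ m → x m * y m

·-comm : ∀ {d} (x y : Vector ℤ d) → x · y ≡ y · x
·-comm x y = sum-cong-≗ λ m → ℤP.*-comm (x m) (y m)

·-scale : ∀ {d} a b (x y : Vector ℤ d) → (λ m → a * x m) · (λ m → b * y m) ≡ (a * b) * (x · y)
·-scale {d} a b x y = begin
  (λ m → a * x m) · (λ m → b * y m)  ≡⟨ sum-cong-≗ (λ m → interchange a b (x m) (y m)) ⟩
  ∑[ m < d ] ((a * b) * (x m * y m)) ≡⟨ *-distribˡ-sum (a * b) (λ m → x m * y m) ⟨
  (a * b) * (x · y)                   ∎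
  where
  open ≡-Reasoning
  interchange : ∀ a b x y → (a * x) * (b * y) ≡ (a * b) * (x * y)
  interchange = solve-∀

·-sumˡ : ∀ {d n} (c : Vector ℤ n) (v : Fin n → Vector ℤ d) (y : Vector ℤ d) →
  (λ m → sum λ u → c u * v u m) · y ≡ sum λ u → c u * (v u · y)
·-sumˡ {d} {n} c v y = begin
  ∑[ m < d ] (∑[ u < n ] (c u * v u m) * y m)   ≡⟨ sum-cong-≗ (λ m → *-distribʳ-sum (y m) (λ u → c u * v u m)) ⟩
  ∑[ m < d ] ∑[ u < n ] (c u * v u m * y m)     ≡⟨ ∑-comm (λ m u → c u * v u m * y m) ⟩
  ∑[ u < n ] ∑[ m < d ] (c u * v u m * y m)     ≡⟨ sum-cong-≗ (λ u → sum-cong-≗ λ m → ℤP.*-assoc (c u) (v u m) (y m)) ⟩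
  ∑[ u < n ] ∑[ m < d ] (c u * (v u m * y m))   ≡⟨ sum-cong-≗ (λ u → *-distribˡ-sum (c u) (λ m → v u m * y m)) ⟨
  ∑[ u < n ] (c u * (v u · y))                    ∎
  where open ≡-Reasoning

0≤i*i : ∀ i → + 0 ℤ.≤ i * i
0≤i*i (+ n)    = subst (+ 0 ℤ.≤_) (sym (ℤP.+◃n≡+n (n ℕ.* n))) (+≤+ z≤n)
0≤i*i -[1+ n ] = +≤+ z≤n

0≤·-self : ∀ {d} (x : Vector ℤ d) → + 0 ℤ.≤ x · x
0≤·-self {ℕ.zero} x = ℤP.≤-refl
0≤·-self {suc d}  x = ℤP.+-mono-≤ (0≤i*i (x zero)) (0≤·-self (x ∘ suc))

i*i≡0⇒i≡0 : ∀ i → i * i ≡ + 0 → i ≡ + 0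
i*i≡0⇒i≡0 i i*i≡0 with ℤP.i*j≡0⇒i≡0∨j≡0 i i*i≡0
... | inj₁ i≡0 = i≡0
... | inj₂ i≡0 = i≡0

0≤i→0≤j→i+j≡0⇒i≡j≡0 : ∀ {i j} → + 0 ℤ.≤ i → + 0 ℤ.≤ j → i + j ≡ + 0 → i ≡ + 0 × j ≡ + 0
0≤i→0≤j→i+j≡0⇒i≡j≡0 (+≤+ {n = m} _) (+≤+ _) i+j≡0 =
  cong +_ (ℕP.m+n≡0⇒m≡0 m m+n≡0) , cong +_ (ℕP.m+n≡0⇒n≡0 m m+n≡0)
  where m+n≡0 = ℤP.+-injective i+j≡0

·-self≡0⇒≡0 : ∀ {d} (x : Vector ℤ d) → x · x ≡ + 0 → ∀ m → x m ≡ + 0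
·-self≡0⇒≡0 x x·x≡0 zero    = i*i≡0⇒i≡0 (x zero)
  (proj₁ (0≤i→0≤j→i+j≡0⇒i≡j≡0 (0≤i*i (x zero)) (0≤·-self (x ∘ suc)) x·x≡0))
·-self≡0⇒≡0 x x·x≡0 (suc m) = ·-self≡0⇒≡0 (x ∘ suc)
  (proj₂ (0≤i→0≤j→i+j≡0⇒i≡j≡0 (0≤i*i (x zero)) (0≤·-self (x ∘ suc)) x·x≡0)) m

·-zeroˡ : ∀ {d} {x : Vector ℤ d} → (∀ m → x m ≡ + 0) → ∀ y → x · y ≡ + 0
·-zeroˡ {d} x≗0 y = trans (sum-cong-≗ λ m → cong (_* y m) (x≗0 m)) (sum-replicate-zero d)

indicator : Bool → ℤ
indicator true  = + 1
indicator false = + 0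

sum-indicator-== : ∀ {n} (x : Fin n) → sum (λ u → indicator (u == x)) ≡ + 1
sum-indicator-== {suc n} zero    = cong (_+_ (+ 1)) (sum-replicate-zero n)
sum-indicator-== {suc n} (suc x) = trans (ℤP.+-identityˡ _) (trans (sum-cong-≗ shift) (sum-indicator-== x))
  where
  shift : ∀ u → indicator (suc u == suc x) ≡ indicator (u == x)
  shift u with u ≟ x
  ... | yes _ = refl
  ... | no  _ = refl

∣∣-sum : ∀ {n} (C : Subset n) → + ∣ C ∣ ≡ sum (indicator ∘ lookup C)
∣∣-sum []          = refl
∣∣-sum (true ∷ C)  = cong (_+_ (+ 1)) (∣∣-sum C)
∣∣-sum (false ∷ C) = trans (∣∣-sum C) (sym (ℤP.+-identityˡ _))

∣∩tabulate∣-sum : ∀ {n} (C : Subset n) (f : Fin n → Bool) →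
  + ∣ C ∩ tabulate f ∣ ≡ sum (λ u → indicator (lookup C u ∧ f u))
∣∩tabulate∣-sum []          f = refl
∣∩tabulate∣-sum (true ∷ C)  f with f zero | ∣∩tabulate∣-sum C (f ∘ suc)
... | true  | ih = cong (_+_ (+ 1)) ih
... | false | ih = trans ih (sym (ℤP.+-identityˡ _))
∣∩tabulate∣-sum (false ∷ C) f = trans (∣∩tabulate∣-sum C (f ∘ suc)) (sym (ℤP.+-identityˡ _))

adjWeight : Bool → ℤ
adjWeight true  = + 8
adjWeight false = - + 8

gramEntry : ∀ {n} → Graph (Fin n) → Fin n → Fin n → ℤ
gramEntry G x y = if x == y then + 24 else adjWeight (adj G x y)

IsGramRepresentation : ∀ {n d} → Graph (Fin n) → (Fin n → Vector ℤ d) → Set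
IsGramRepresentation G v = ∀ x y → v x · v y ≡ gramEntry G x y

m+8n²≡32n⇒n≤4 : ∀ m n → m ℕ.+ 8 ℕ.* n ℕ.* n ≡ 32 ℕ.* n → n ≤ 4
m+8n²≡32n⇒n≤4 m n eq with n ℕ.≤? 4
... | yes n≤4 = n≤4
... | no  n≰4 = contradiction (sym eq) (ℕP.<⇒≢ 32n<m+8n²)
  where
  open ℕP.≤-Reasoning
  4<n = ℕP.≰⇒> n≰4
  instance
    _ = >-nonZero (ℕP.<-trans z<s 4<n)
  32n<m+8n² : 32 ℕ.* n ℕ.< m ℕ.+ 8 ℕ.* n ℕ.* n
  32n<m+8n² = begin-strict
    32 ℕ.* n            <⟨ ℕP.*-monoˡ-< n (ℕP.m<m+n 32 {8} z<s) ⟩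
    8 ℕ.* 5 ℕ.* n       ≤⟨ ℕP.*-monoˡ-≤ n (ℕP.*-monoʳ-≤ 8 4<n) ⟩
    8 ℕ.* n ℕ.* n       ≤⟨ ℕP.m≤n+m _ m ⟩
    m ℕ.+ 8 ℕ.* n ℕ.* n ∎

module CocliqueInGramRepresentation
  {n d} (G : Graph (Fin n)) (v : Fin n → Vector ℤ d) (gram : IsGramRepresentation G v)
  (C : Subset n) (coclique : IsCoclique G C) where

  χ : Vector ℤ n
  χ = indicator ∘ lookup C

  S : Vector ℤ d
  S m = sum λ u → χ u * v u m

  S·v∈ : ∀ {x} → x ∈ C → S · v x ≡ - + 8 * + ∣ C ∣ + + 32
  S·v∈ {x} x∈C = begin
    S · v x                                             ≡⟨ ·-sumˡ χ v (v x) ⟩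
    sum (λ u → χ u * (v u · v x))                       ≡⟨ sum-cong-≗ term ⟩
    sum (λ u → - + 8 * χ u + + 32 * indicator (u == x)) ≡⟨ ∑-distrib-+ (λ u → - + 8 * χ u) _ ⟩
    sum (λ u → - + 8 * χ u) + sum (λ u → + 32 * indicator (u == x))
      ≡⟨ cong₂ _+_ (sym (*-distribˡ-sum (- + 8) χ)) (sym (*-distribˡ-sum (+ 32) (λ u → indicator (u == x)))) ⟩
    - + 8 * sum χ + + 32 * sum (λ u → indicator (u == x))
      ≡⟨ cong₂ (λ k δ → - + 8 * k + + 32 * δ) (sym (∣∣-sum C)) (sum-indicator-== x) ⟩
    - + 8 * + ∣ C ∣ + + 32                              ∎
    where
    open ≡-Reasoning
    term : ∀ u → χ u * (v u · v x) ≡ - + 8 * χ u + + 32 * indicator (u == x)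
    term u rewrite gram u x with u ≟ x
    ... | yes refl rewrite []=⇒lookup x∈C = refl
    ... | no _ with lookup C u in u∈?C
    ...   | false = refl
    ...   | true rewrite coclique u x (lookup⇒[]= u C u∈?C) x∈C = refl

  S·v∉ : ∀ {x} → x ∉ C → S · v x ≡ - + 8 * + ∣ C ∣ + + 16 * + ∣ C ∩ nbhd G x ∣
  S·v∉ {x} x∉C = begin
    S · v x                                                             ≡⟨ ·-sumˡ χ v (v x) ⟩
    sum (λ u → χ u * (v u · v x))                                       ≡⟨ sum-cong-≗ term ⟩
    sum (λ u → - + 8 * χ u + + 16 * indicator (lookup C u ∧ adj G x u)) ≡⟨ ∑-distrib-+ (λ u → - + 8 * χ u) _ ⟩
    sum (λ u → - + 8 * χ u) + sum (λ u → + 16 * indicator (lookup C u ∧ adj G x u))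
      ≡⟨ cong₂ _+_ (sym (*-distribˡ-sum (- + 8) χ))
                   (sym (*-distribˡ-sum (+ 16) (λ u → indicator (lookup C u ∧ adj G x u)))) ⟩
    - + 8 * sum χ + + 16 * sum (λ u → indicator (lookup C u ∧ adj G x u))
      ≡⟨ cong₂ (λ k m → - + 8 * k + + 16 * m) (sym (∣∣-sum C)) (sym (∣∩tabulate∣-sum C (adj G x))) ⟩
    - + 8 * + ∣ C ∣ + + 16 * + ∣ C ∩ nbhd G x ∣                         ∎
    where
    open ≡-Reasoning
    term : ∀ u → χ u * (v u · v x) ≡ - + 8 * χ u + + 16 * indicator (lookup C u ∧ adj G x u)
    term u rewrite gram u x with lookup C u in u∈?C
    ... | false = refl
    ... | true with u ≟ x
    ...   | yes refl = contradiction (lookup⇒[]= u C u∈?C) x∉C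
    ...   | no _ rewrite symm G u x with adj G x u
    ...     | true  = refl
    ...     | false = refl

  S·S : S · S ≡ + ∣ C ∣ * (- + 8 * + ∣ C ∣ + + 32)
  S·S = begin
    S · S                                     ≡⟨ ·-sumˡ χ v S ⟩
    sum (λ u → χ u * (v u · S))               ≡⟨ sum-cong-≗ term ⟩
    sum (λ u → χ u * (- + 8 * + ∣ C ∣ + + 32)) ≡⟨ *-distribʳ-sum (- + 8 * + ∣ C ∣ + + 32) χ ⟨
    sum χ * (- + 8 * + ∣ C ∣ + + 32)           ≡⟨ cong (_* (- + 8 * + ∣ C ∣ + + 32)) (∣∣-sum C) ⟨
    + ∣ C ∣ * (- + 8 * + ∣ C ∣ + + 32)         ∎
    where
    open ≡-Reasoning
    term : ∀ u → χ u * (v u · S) ≡ χ u * (- + 8 * + ∣ C ∣ + + 32)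
    term u with lookup C u in u∈?C
    ... | false = refl
    ... | true  = cong (+ 1 *_) (trans (·-comm (v u) S) (S·v∈ (lookup⇒[]= u C u∈?C)))

  ∣C∣≤4 : ∣ C ∣ ≤ 4
  ∣C∣≤4 = m+8n²≡32n⇒n≤4 ℤ.∣ S · S ∣ k (ℤP.+-injective normEquation)
    where
    open ≡-Reasoning
    k = ∣ C ∣
    normEquation : + (ℤ.∣ S · S ∣ ℕ.+ 8 ℕ.* k ℕ.* k) ≡ + (32 ℕ.* k)
    normEquation = begin
      + (ℤ.∣ S · S ∣ ℕ.+ 8 ℕ.* k ℕ.* k)              ≡⟨ ℤP.pos-+ ℤ.∣ S · S ∣ (8 ℕ.* k ℕ.* k) ⟩
      + ℤ.∣ S · S ∣ + + (8 ℕ.* k ℕ.* k)              ≡⟨ cong₂ _+_ (ℤP.0≤i⇒+∣i∣≡i (0≤·-self S))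
                                                               (trans (ℤP.pos-* (8 ℕ.* k) k) (cong (_* + k) (ℤP.pos-* 8 k))) ⟩
      S · S + + 8 * + k * + k                      ≡⟨ cong (_+ + 8 * + k * + k) S·S ⟩
      + k * (- + 8 * + k + + 32) + + 8 * + k * + k ≡⟨ expand (+ k) ⟩
      + 32 * + k                                   ≡⟨ ℤP.pos-* 32 k ⟨
      + (32 ℕ.* k)                                 ∎
      where
      expand : ∀ i → i * (- + 8 * i + + 32) + + 8 * i * i ≡ + 32 * i
      expand = solve-∀

  ∣C∣≡4⇒2-regular : ∣ C ∣ ≡ 4 → ∀ x → x ∉ C → ∣ C ∩ nbhd G x ∣ ≡ 2
  ∣C∣≡4⇒2-regular ∣C∣≡4 x x∉C = ℕP.*-cancelˡ-≡ m 2 16 (ℤP.+-injective (begin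
    + (16 ℕ.* m)                          ≡⟨ ℤP.pos-* 16 m ⟩
    + 16 * + m                            ≡⟨ expand (+ m) ⟩
    - + 8 * + 4 + + 16 * + m + + 32       ≡⟨ cong (λ k → - + 8 * + k + + 16 * + m + + 32) ∣C∣≡4 ⟨
    - + 8 * + ∣ C ∣ + + 16 * + m + + 32   ≡⟨ cong (_+ + 32) (S·v∉ x∉C) ⟨
    S · v x + + 32                        ≡⟨ cong (_+ + 32) (·-zeroˡ S≡0 (v x)) ⟩
    + 32                                  ∎))
    where
    open ≡-Reasoning
    m = ∣ C ∩ nbhd G x ∣
    expand : ∀ i → + 16 * i ≡ - + 8 * + 4 + + 16 * i + + 32
    expand = solve-∀
    S≡0 : ∀ m → S m ≡ + 0
    S≡0 = ·-self≡0⇒≡0 S (trans S·S (cong (λ k → + k * (- + 8 * + k + + 32)) ∣C∣≡4))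

pairVector : ∀ {d} → Fin d → Fin d → Vector ℤ d
pairVector i j m = if (m == i) ∨ (m == j) then + 3 else - + 1

-- The body of lineAdj on endpoints, so that lineAdj H e f reduces to touches of those of e and f.
touches : ∀ {d} → Fin d → Fin d → Fin d → Fin d → Bool
touches i j k l = ((i == k) ∨ (i == l) ∨ (j == k) ∨ (j == l)) ∧ not ((i == k) ∧ (j == l))

pairGram : ∀ {d} → Fin d → Fin d → Fin d → Fin d → ℤ
pairGram i j k l = if (i == k) ∧ (j == l) then + 24 else adjWeight (touches i j k l)

-- Exhaustive check of ⟨w_{ij}, w_{kl}⟩ = 16 |{i,j} ∩ {k,l}| − 8.
pairVector-· : (i j k l : Fin 8) → i < j → k < l → pairVector i j · pairVector k l ≡ pairGram i j k l
pairVector-· = toWitness {a? = all? λ i → all? λ j → all? λ k → all? λ l →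
  (i <? j) →-dec (k <? l) →-dec (pairVector i j · pairVector k l ℤ.≟ pairGram i j k l)} tt

==-refl : ∀ {d} (i : Fin d) → i == i ≡ true
==-refl i with i ≟ i
... | yes _   = refl
... | no  i≢i = contradiction refl i≢i

==-∧-false : ∀ {d} {i j k l : Fin d} → ¬ (i ≡ k × j ≡ l) → (i == k) ∧ (j == l) ≡ false
==-∧-false {i = i} {j} {k} {l} ij≉kl with i ≟ k | j ≟ l
... | yes i≡k | yes j≡l = contradiction (i≡k , j≡l) ij≉kl
... | yes _   | no  _   = refl
... | no  _   | _       = refl

pairVector-·-self : ∀ {i j : Fin 8} → i < j → pairVector i j · pairVector i j ≡ + 24
pairVector-·-self {i} {j} i<j = trans (pairVector-· i j i j i<j i<j)
  (cong (λ b → if b then + 24 else adjWeight (touches i j i j)) (cong₂ _∧_ (==-refl i) (==-refl j)))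

pairVector-·-distinct : ∀ {i j k l : Fin 8} → i < j → k < l → ¬ (i ≡ k × j ≡ l) →
  pairVector i j · pairVector k l ≡ adjWeight (touches i j k l)
pairVector-·-distinct {i} {j} {k} {l} i<j k<l ij≉kl = trans (pairVector-· i j k l i<j k<l)
  (cong (λ b → if b then + 24 else adjWeight (touches i j k l)) (==-∧-false ij≉kl))

Edge-≡ : ∀ {m} (H : Graph (Fin m)) {e f : Edge H} → src H e ≡ src H f → tgt H e ≡ tgt H f → e ≡ f
Edge-≡ H {i , j , i<j , ij∈H} {_ , _ , i<j′ , ij∈H′} refl refl =
  cong₂ (λ p q → i , j , p , q) (Fin.<-irrelevant i<j i<j′) (Decidable⇒UIP.≡-irrelevant 𝔹._≟_ ij∈H ij∈H′)

sign : Bool → ℤ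
sign true  = - + 1
sign false = + 1

sign-* : ∀ a b → sign a * sign b ≡ sign (a xor b)
sign-* true  true  = refl
sign-* true  false = refl
sign-* false true  = refl
sign-* false false = refl

sign-*-adjWeight : ∀ a b → sign a * adjWeight b ≡ adjWeight (if a then not b else b)
sign-*-adjWeight true  true  = refl
sign-*-adjWeight true  false = refl
sign-*-adjWeight false true  = refl
sign-*-adjWeight false false = refl

module SwitchedLineGraph (H : Graph (Fin 8)) (X : Edge H → Bool) where

  switchedVector : Edge H → Vector ℤ 8
  switchedVector e m = sign (X e) * pairVector (src H e) (tgt H e) m

  switchedVector-·-self : ∀ e → switchedVector e · switchedVector e ≡ + 24
  switchedVector-·-self e@(i , j , i<j , _) = begin
    switchedVector e · switchedVector e                        ≡⟨ ·-scale (sign (X e)) (sign (X e)) (pairVector i j) (pairVector i j) ⟩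
    sign (X e) * sign (X e) * (pairVector i j · pairVector i j) ≡⟨ cong₂ _*_ (sign-* (X e) (X e)) (pairVector-·-self i<j) ⟩
    sign (X e xor X e) * + 24                                   ≡⟨ cong (λ b → sign b * + 24) (𝔹.xor-same (X e)) ⟩
    + 24                                                        ∎
    where open ≡-Reasoning

  switchedVector-·-distinct : ∀ {e f} → e ≢ f → switchedVector e · switchedVector f ≡ adjWeight (switch (lineAdj H) X e f)
  switchedVector-·-distinct {e@(i , j , i<j , _)} {f@(k , l , k<l , _)} e≢f = begin
    switchedVector e · switchedVector f                         ≡⟨ ·-scale (sign (X e)) (sign (X f)) (pairVector i j) (pairVector k l) ⟩
    sign (X e) * sign (X f) * (pairVector i j · pairVector k l) ≡⟨ cong₂ _*_ (sign-* (X e) (X f)) (pairVector-·-distinct i<j k<l e≉f) ⟩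
    sign (X e xor X f) * adjWeight (lineAdj H e f)              ≡⟨ sign-*-adjWeight (X e xor X f) (lineAdj H e f) ⟩
    adjWeight (switch (lineAdj H) X e f)                        ∎
    where
    open ≡-Reasoning
    e≉f : ¬ (i ≡ k × j ≡ l)
    e≉f (i≡k , j≡l) = e≢f (Edge-≡ H i≡k j≡l)

InS8⇒gramRepresentation : ∀ {n} (G : Graph (Fin n)) → InS8 G → Σ (Fin n → Vector ℤ 8) (IsGramRepresentation G)
InS8⇒gramRepresentation G (H , X , φ , G≅L[H]X) = switchedVector ∘ Bijection.to φ , gram
  where
  open SwitchedLineGraph H X
  gram : IsGramRepresentation G (switchedVector ∘ Bijection.to φ)
  gram x y with x ≟ y
  ... | yes refl = switchedVector-·-self (Bijection.to φ x)
  ... | no x≢y = trans (switchedVector-·-distinct (x≢y ∘ Bijection.injective φ)) (cong adjWeight (sym (G≅L[H]X x y)))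

mainTheorem18 : {n : ℕ} (G : Graph (Fin n)) → InS8 G → (C : Subset n) → IsCoclique G C →
    (∣ C ∣ ≤ 4) × (∣ C ∣ ≡ 4 → ∀ v → v ∉ C → ∣ C ∩ nbhd G v ∣ ≡ 2)
mainTheorem18 G G∈𝒮₈ C coclique = ∣C∣≤4 , ∣C∣≡4⇒2-regular
  where
  representation = InS8⇒gramRepresentation G G∈𝒮₈
  open CocliqueInGramRepresentation G (proj₁ representation) (proj₂ representation) C coclique
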